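{- Let $m,t,g$ be natural numbers with $m>0$. For every list $\ell$ of natural numbers, every list $St$ of natural numbers of length at most $m$, and every natural number $X$ with $X> mg+1-\sum_{e\in\ell} e$ (integer subtraction), if $\mathrm{OnlineInfeasible}(X,\ell,St)$ holds then $\mathrm{LowerBoundBS}(\ell,St)$ holds.
   Context: Lists: $e::\ell$ denotes the list with head $e$ and tail $\ell$. For a list $St$ of naturals, $\max(St)$ is its maximum element ($0$ for the empty list). $\mathrm{AddToBin}(St,e,b)$ is defined recursively: $\mathrm{AddToBin}([\,],e,b)=[e]$; $\mathrm{AddToBin}(x::s,e,0)=(x+e)::s$; $\mathrm{AddToBin}(x::s,e,k+1)=x::\mathrm{AddToBin}(s,e,k)$. A solution packing of a list $\ell$ is a list $P$ of exactly $m$ lists of naturals such that every natural $v$ occurs in the concatenation of $P$ at least as many times as in $\ell$, and each list of $P$ has sum at most $g$. $\mathrm{OnlineInfeasible}$ is the smallest relation on triples $(X,\ell,St)$ ($X$ natural, $\ell$ and $St$ lists of naturals) such that: (Overflow) if $t\le \max(St)$ and $\ell$ has a solution packing, then $\mathrm{OnlineInfeasible}(X,\ell,St)$ for every $X$; (Deadend) if $\mathrm{length}(St)\le m$ and there is a natural $e\ge1$ such that $\mathrm{OnlineInfeasible}(X,e::\ell,\mathrm{AddToBin}(St,e,b))$ holds for every $b<m$, then $\mathrm{OnlineInfeasible}(X+1,\ell,St)$. $\mathrm{LowerBoundBS}(\ell,St)$ means the following for the game with parameters $m,t,g$ started from the state $(\ell,St)$, where $St$ padded with zeros to length $m$ gives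 the initial loads of bins $0,\dots,m-1$ of the player Algorithm: in rounds $i=1,2,\dots$, Adversary chooses a positive integer $e_i$ and Algorithm chooses a bin $b_i\in\{0,\dots,m-1\}$; Adversary wins if at some round $j\ge 0$ (round $0$ meaning before any further item) some bin $b$ satisfies $St[b]+\sum_{i\le j,\ b_i=b}e_i\ge t$ and the multiset $\ell\cup\{e_i:i\le j\}$ can be partitioned into $m$ parts each of sum at most $g$; $\mathrm{LowerBoundBS}(\ell,St)$ holds iff Adversary has a strategy winning against every behaviour of Algorithm. -}

module Defs where

open import Data.Nat using (ℕ; zero; suc; _+_; _*_; _≤_; _<_; _⊔_; _≟_)
open import Data.Fin using (Fin; toℕ)
open import Data.List using (List; []; _∷_; _++_; length; map; concat; foldr)
open import Data.Nat.ListAction using (sum)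
open import Data.List.Relation.Unary.All using (All)
open import Data.List.Relation.Binary.Permutation.Propositional using (_↭_)
open import Data.Product using (Σ; ∃; _×_; _,_; proj₁; proj₂)
open import Relation.Binary.PropositionalEquality using (_≡_)
open import Relation.Nullary using (does)
open import Data.Bool using (if_then_else_)

maxL : List ℕ → ℕ
maxL = foldr _⊔_ 0

AddToBin : List ℕ → ℕ → ℕ → List ℕ
AddToBin []      e b       = e ∷ []
AddToBin (x ∷ s) e zero    = (x + e) ∷ s
AddToBin (x ∷ s) e (suc k) = x ∷ AddToBin s e k

occ : ℕ → List ℕ → ℕ
occ v []       = 0
occ v (x ∷ xs) = (if does (x ≟ v) then 1 else 0) + occ v xs

SolutionPacking : (m g : ℕ) → List ℕ → Set
SolutionPacking m g ℓ =
  Σ (List (List ℕ)) λ P →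
    (length P ≡ m) ×
    ((v : ℕ) → occ v ℓ ≤ occ v (concat P)) ×
    All (λ bin → sum bin ≤ g) P

data OnlineInfeasible (m t g : ℕ) : ℕ → List ℕ → List ℕ → Set where
  overflow : ∀ {X ℓ St} → t ≤ maxL St → SolutionPacking m g ℓ →
             OnlineInfeasible m t g X ℓ St
  deadend  : ∀ {X ℓ St} → length St ≤ m → (e : ℕ) → 1 ≤ e →
             ((b : ℕ) → b < m → OnlineInfeasible m t g X (e ∷ ℓ) (AddToBin St e b)) →
             OnlineInfeasible m t g (suc X) ℓ St

load : List ℕ → ℕ → ℕ
load []      _       = 0
load (x ∷ _) zero    = x
load (_ ∷ s) (suc i) = load s i

-- A history: list of (item, chosen bin) pairs, most recent first
History : ℕ → Set
History m = List (ℕ × Fin m)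

record AdvStrategy (m : ℕ) : Set where
  field
    next    : History m → ℕ
    nextPos : (h : History m) → 1 ≤ next h
open AdvStrategy public

AlgBehaviour : ℕ → Set
AlgBehaviour m = History m → ℕ → Fin m

play : ∀ {m} → AdvStrategy m → AlgBehaviour m → ℕ → History m
play A B zero    = []
play A B (suc j) = let h = play A B j ; e = next A h in (e , B h e) ∷ h

binSum : ∀ {m} → Fin m → History m → ℕ
binSum b []            = 0
binSum b ((e , c) ∷ h) = (if does (toℕ c ≟ toℕ b) then e else 0) + binSum b h

Partitionable : (m g : ℕ) → List ℕ → Set
Partitionable m g ℓ =
  Σ (List (List ℕ)) λ P → (length P ≡ m) × (concat P ↭ ℓ) × All (λ bin → sum bin ≤ g) P

AdvWinsAt : (m t g : ℕ) → List ℕ → List ℕ → History m → Set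
AdvWinsAt m t g ℓ St h =
  (Σ (Fin m) λ b → t ≤ load St (toℕ b) + binSum b h) ×
  Partitionable m g (ℓ ++ map proj₁ h)

LowerBoundBS : (m t g : ℕ) → List ℕ → List ℕ → Set
LowerBoundBS m t g ℓ St =
  Σ (AdvStrategy m) λ A → (B : AlgBehaviour m) →
    ∃ λ j → AdvWinsAt m t g ℓ St (play A B j)

module Submission where

-- Adversary replays a derivation D of OnlineInfeasible(X, ℓ, St)
-- against the actual Algorithm.  The abstract state St of the derivation lists
-- the loads of the "abstract bins" opened so far; the strategy keeps a list σ of
-- pairwise distinct real bins, σ[i] being the real bin that plays abstract bin i,
-- with the invariant that every abstract load is at most the real load of its
-- bin.  At a Deadend node D offers item e; when Algorithm answers with real bin c
-- the strategy follows the child for abstract bin i if c = σ[i], and otherwise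
-- opens a fresh abstract bin (possible since σ has fewer than m entries).  The
-- derivation is finite, so an Overflow node is reached: some abstract load, hence
-- some real load, is at least t, and the solution packing of the items seen so
-- far yields the partition required for Adversary's win.

open import Defs
open import Data.Bool using (if_then_else_)
open import Data.Empty using (⊥-elim)
open import Data.Fin using (Fin; toℕ; fromℕ<) renaming (zero to fzero; suc to fsuc)
open import Data.Fin.Properties using (toℕ<n; injective⇒≤) renaming (suc-injective to fsuc-injective; _≟_ to _≟ᶠ_)
open import Data.List using (List; []; _∷_; _++_; [_]; length; map; concat; lookup)
open import Data.List.Properties using (++-identityʳ)
open import Data.List.Membership.Propositional using (_∈_; _∉_)
open import Data.List.Membership.Propositional.Properties using (∈-lookup; ∈-∃++)
open import Data.List.Relation.Binary.Permutation.Propositional using (_↭_; refl; prep; swap; trans; ↭-sym; ↭-reflexive)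
open import Data.List.Relation.Binary.Permutation.Propositional.Properties using (shift)
open import Data.List.Relation.Binary.Pointwise using (Pointwise; []; _∷_; Pointwise-length)
  renaming (map to pointwise-map)
open import Data.List.Relation.Binary.Sublist.Propositional using (_⊆_; []; _∷_; _∷ʳ_; minimum)
open import Data.List.Relation.Binary.Sublist.Propositional.Properties using (++⁺)
open import Data.List.Relation.Unary.All using (All; []; _∷_; universal)
import Data.List.Relation.Unary.All as All
open import Data.List.Relation.Unary.All.Properties using (¬Any⇒All¬)
import Data.List.Relation.Unary.All.Properties as AllP
open import Data.List.Relation.Unary.Any using (here; there; index)
open import Data.List.Relation.Unary.Unique.Propositional using (Unique; []; _∷_)
import Data.List.Relation.Unary.Unique.Propositional.Properties as UniqueP
open import Data.Nat using (ℕ; suc; _+_; _*_; _≤_; _<_; _≟_; z≤n; s≤s)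
open import Data.Nat.ListAction using (sum)
open import Data.Nat.Properties
open import Algebra.Properties.CommutativeSemigroup +-commutativeSemigroup using (x∙yz≈y∙xz)
open import Data.Product using (Σ; ∃; ∃₂; _×_; _,_; proj₁)
open import Data.Sum using (inj₁; inj₂)
open import Relation.Binary.PropositionalEquality using (_≡_; _≢_; refl; sym; cong; subst; module ≡-Reasoning)
  renaming (trans to ≡-trans)
open import Relation.Nullary using (Dec; yes; no; does)
open import Relation.Nullary.Decidable using (dec-true; dec-false)

occHere : ℕ → ℕ → ℕ
occHere x v = if does (x ≟ v) then 1 else 0

occ-↭ : ∀ v {xs ys} → xs ↭ ys → occ v xs ≡ occ v ys
occ-↭ v refl         = refl
occ-↭ v (prep x p)   = cong (occHere x v +_) (occ-↭ v p)
occ-↭ v (swap x y p) = ≡-trans (cong (λ n → occHere x v + (occHere y v + n)) (occ-↭ v p))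
                               (x∙yz≈y∙xz (occHere x v) (occHere y v) _)
occ-↭ v (trans p q)  = ≡-trans (occ-↭ v p) (occ-↭ v q)

occHere-hit : ∀ x → occHere x x ≡ 1
occHere-hit x = cong (λ b → if b then 1 else 0) (dec-true (x ≟ x) refl)

occHere-miss : ∀ {y x} → y ≢ x → occHere y x ≡ 0
occHere-miss {y} {x} y≢x = cong (λ b → if b then 1 else 0) (dec-false (y ≟ x) y≢x)

occ-head : ∀ x xs → 0 < occ x (x ∷ xs)
occ-head x xs = subst (λ n → 0 < n + occ x xs) (sym (occHere-hit x)) (s≤s z≤n)

occ⇒∈ : ∀ {x} xs → 0 < occ x xs → x ∈ xs
occ⇒∈ {x} (y ∷ xs) pos with y ≟ x
... | yes refl = here refl
... | no y≢x   = there (occ⇒∈ xs (subst (λ n → 0 < n + occ x xs) (occHere-miss y≢x) pos))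

⊆-++-split : ∀ {A : Set} {zs : List A} xs {ys} → zs ⊆ xs ++ ys →
             ∃₂ λ as bs → as ++ bs ≡ zs × as ⊆ xs × bs ⊆ ys
⊆-++-split []       τ        = [] , _ , refl , [] , τ
⊆-++-split (x ∷ xs) (.x ∷ʳ τ) with ⊆-++-split xs τ
... | as , bs , refl , as⊆ , bs⊆ = as , bs , refl , x ∷ʳ as⊆ , bs⊆
⊆-++-split (x ∷ xs) (refl ∷ τ) with ⊆-++-split xs τ
... | as , bs , refl , as⊆ , bs⊆ = x ∷ as , bs , refl , refl ∷ as⊆ , bs⊆

⊆-concat-split : ∀ {A : Set} {zs : List A} (P : List (List A)) → zs ⊆ concat P →
                 Σ (List (List A)) λ Q → concat Q ≡ zs × Pointwise _⊆_ Q P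
⊆-concat-split []      []  = [] , refl , []
⊆-concat-split (p ∷ P) τ with ⊆-++-split p τ
... | as , bs , refl , as⊆ , bs⊆ with ⊆-concat-split P bs⊆
...   | Q , refl , Q⊆ = as ∷ Q , refl , as⊆ ∷ Q⊆

sum-⊆ : ∀ {xs ys} → xs ⊆ ys → sum xs ≤ sum ys
sum-⊆ []                 = z≤n
sum-⊆ (y ∷ʳ τ)           = ≤-trans (sum-⊆ τ) (m≤n+m _ y)
sum-⊆ {x ∷ _} (refl ∷ τ) = +-monoʳ-≤ x (sum-⊆ τ)

occ-dominated⇒subbag : ∀ ℓ L → (∀ v → occ v ℓ ≤ occ v L) →
                       Σ (List ℕ) λ ℓ′ → ℓ′ ⊆ L × ℓ′ ↭ ℓ
occ-dominated⇒subbag []      L dom = [] , minimum L , refl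
occ-dominated⇒subbag (x ∷ ℓ) L dom
  with ∈-∃++ (occ⇒∈ L (≤-trans (occ-head x ℓ) (dom x)))
... | A , B , refl
  with occ-dominated⇒subbag ℓ (A ++ B) dom′
  where
  -- removing one copy of x from both sides keeps the domination
  dom′ : ∀ v → occ v ℓ ≤ occ v (A ++ B)
  dom′ v = +-cancelˡ-≤ (occHere x v) _ _
             (subst (occ v (x ∷ ℓ) ≤_) (occ-↭ v (shift x A B)) (dom v))
... | ℓ″ , ℓ″⊆ , ℓ″↭ℓ with ⊆-++-split A ℓ″⊆
...   | as , bs , refl , as⊆ , bs⊆ =
        as ++ x ∷ bs , ++⁺ as⊆ (refl ∷ bs⊆) , trans (shift x as bs) (prep x ℓ″↭ℓ)

-- A solution packing of ℓ gives a partition of any permutation of ℓ into m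
-- parts of sum at most g: drop the surplus items from the bins.
packing⇒partitionable : ∀ {m g ℓ ℓ′} → SolutionPacking m g ℓ → ℓ ↭ ℓ′ →
                        Partitionable m g ℓ′
packing⇒partitionable {ℓ = ℓ} (P , lenP , dom , fits) ℓ↭ℓ′
  with occ-dominated⇒subbag ℓ (concat P) dom
... | ℓ″ , ℓ″⊆ , ℓ″↭ℓ with ⊆-concat-split P ℓ″⊆
...   | Q , refl , Q⊆P =
        Q , ≡-trans (Pointwise-length Q⊆P) lenP , trans ℓ″↭ℓ ℓ↭ℓ′ , shrink Q⊆P fits
  where
  shrink : ∀ {g Q P} → Pointwise _⊆_ Q P → All (λ p → sum p ≤ g) P →
           All (λ q → sum q ≤ g) Q
  shrink []          []           = []
  shrink (q⊆p ∷ Q⊆P) (p≤g ∷ fits) = ≤-trans (sum-⊆ q⊆p) p≤g ∷ shrink Q⊆P fits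

lookup-injective : ∀ {A : Set} {xs : List A} → Unique xs →
                   ∀ {i j} → lookup xs i ≡ lookup xs j → i ≡ j
lookup-injective (x∉xs ∷ u) {fzero}  {fzero}  _  = refl
lookup-injective (x∉xs ∷ u) {fzero}  {fsuc j} eq = ⊥-elim (All.lookup x∉xs (∈-lookup j) eq)
lookup-injective (x∉xs ∷ u) {fsuc i} {fzero}  eq = ⊥-elim (All.lookup x∉xs (∈-lookup i) (sym eq))
lookup-injective (_    ∷ u) {fsuc i} {fsuc j} eq = cong fsuc (lookup-injective u eq)

unique-length≤ : ∀ {n} {σ : List (Fin n)} → Unique σ → length σ ≤ n
unique-length≤ u = injective⇒≤ (lookup-injective u)

index<n : ∀ {n c} {σ : List (Fin n)} → Unique σ → (c∈σ : c ∈ σ) → toℕ (index c∈σ) < n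
index<n u c∈σ = <-≤-trans (toℕ<n (index c∈σ)) (unique-length≤ u)

fresh<n : ∀ {n c} {σ : List (Fin n)} → Unique σ → c ∉ σ → length σ < n
fresh<n {σ = σ} u c∉σ = unique-length≤ (¬Any⇒All¬ σ c∉σ ∷ u)

unique-snoc : ∀ {A : Set} {c : A} {σ} → Unique σ → c ∉ σ → Unique (σ ++ [ c ])
unique-snoc u c∉σ = UniqueP.++⁺ u ([] ∷ []) λ { (c∈σ , here refl) → c∉σ c∈σ }

firstBins : ∀ {n} (St : List ℕ) → length St ≤ n → List (Fin n)
firstBins []       _        = []
firstBins (_ ∷ St) (s≤s le) = fzero ∷ map fsuc (firstBins St le)

firstBins-unique : ∀ {n} St (le : length St ≤ n) → Unique (firstBins St le)
firstBins-unique []       _        = []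
firstBins-unique (_ ∷ St) (s≤s le) =
  AllP.map⁺ (universal (λ _ ()) _) ∷ UniqueP.map⁺ fsuc-injective (firstBins-unique St le)

Dominated : ∀ {n} → (Fin n → ℕ) → List ℕ → List (Fin n) → Set
Dominated L = Pointwise (λ x c → x ≤ L c)

module _ {n : ℕ} {L L′ : Fin n → ℕ} (grown : ∀ c → L c ≤ L′ c) where

  dominated-mono : ∀ {St σ} → Dominated L St σ → Dominated L′ St σ
  dominated-mono = pointwise-map (λ {_} {c} x≤ → ≤-trans x≤ (grown c))

  dominated-add : ∀ {St σ c} e → Dominated L St σ → (c∈σ : c ∈ σ) → L c + e ≤ L′ c →
                  Dominated L′ (AddToBin St e (toℕ (index c∈σ))) σ
  dominated-add e (x≤ ∷ d) (here refl) filled = ≤-trans (+-monoˡ-≤ e x≤) filled ∷ dominated-mono d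
  dominated-add e (_∷_ {y = c′} x≤ d) (there c∈σ) filled =
    ≤-trans x≤ (grown c′) ∷ dominated-add e d c∈σ filled

  dominated-open : ∀ {St σ c} e → Dominated L St σ → e ≤ L′ c →
                   Dominated L′ (AddToBin St e (length σ)) (σ ++ [ c ])
  dominated-open e []                  filled = filled ∷ []
  dominated-open e (_∷_ {y = c′} x≤ d) filled = ≤-trans x≤ (grown c′) ∷ dominated-open e d filled

dominated-max : ∀ {n t St σ} {L : Fin n → ℕ} → 0 < n → Dominated L St σ → t ≤ maxL St →
                Σ (Fin n) λ c → t ≤ L c
dominated-max n>0 [] t≤0 = fromℕ< n>0 , ≤-trans t≤0 z≤n
dominated-max {t = t} {x ∷ St} {c ∷ _} n>0 (x≤ ∷ d) t≤max with ⊔-sel x (maxL St)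
... | inj₁ max≡x = c , ≤-trans (subst (t ≤_) max≡x t≤max) x≤
... | inj₂ max≡rest = dominated-max n>0 d (subst (t ≤_) max≡rest t≤max)

firstBins-dominated : ∀ {n} St (le : length St ≤ n) →
                      Dominated (λ c → load St (toℕ c)) St (firstBins St le)
firstBins-dominated []       _        = []
firstBins-dominated (_ ∷ St) (s≤s le) = ≤-refl ∷ shiftBins (firstBins-dominated St le)
  where
  shiftBins : ∀ {n St σ} {L : Fin (suc n) → ℕ} → Dominated (λ c → L (fsuc c)) St σ →
              Dominated L St (map fsuc σ)
  shiftBins []       = []
  shiftBins (x≤ ∷ d) = x≤ ∷ shiftBins d

realLoad : ∀ {n} → List ℕ → History n → Fin n → ℕ
realLoad St h c = load St (toℕ c) + binSum c h

realLoad-mono : ∀ {n} St (h : History n) E c c′ → realLoad St h c′ ≤ realLoad St ((E , c) ∷ h) c′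
realLoad-mono St h E c c′ = +-monoʳ-≤ (load St (toℕ c′)) (m≤n+m (binSum c′ h) _)

realLoad-chosen : ∀ {n} St (h : History n) E c → realLoad St h c + E ≤ realLoad St ((E , c) ∷ h) c
realLoad-chosen St h E c = ≤-reflexive (begin
  load St (toℕ c) + binSum c h + E   ≡⟨ +-assoc (load St (toℕ c)) (binSum c h) E ⟩
  load St (toℕ c) + (binSum c h + E) ≡⟨ cong (load St (toℕ c) +_) (+-comm (binSum c h) E) ⟩
  load St (toℕ c) + (E + binSum c h) ≡⟨ cong (λ b → load St (toℕ c) + ((if b then E else 0) + binSum c h))
                                              (sym (dec-true (toℕ c ≟ toℕ c) refl)) ⟩
  realLoad St ((E , c) ∷ h) c        ∎)
  where open ≡-Reasoning

module Replay (m t g : ℕ) where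

  open import Data.List.Membership.DecPropositional (_≟ᶠ_ {m}) using (_∈?_)

  data Position : Set where
    at : ∀ {X ℓ St} → OnlineInfeasible m t g X ℓ St → (σ : List (Fin m)) → Unique σ → Position

  itemAt : Position → ℕ
  itemAt (at (overflow _ _)    _ _) = 1
  itemAt (at (deadend _ e _ _) _ _) = e

  itemAt-positive : ∀ P → 1 ≤ itemAt P
  itemAt-positive (at (overflow _ _)      _ _) = s≤s z≤n
  itemAt-positive (at (deadend _ _ e≥1 _) _ _) = e≥1

  follow : ∀ {X ℓ St e} → ((b : ℕ) → b < m → OnlineInfeasible m t g X (e ∷ ℓ) (AddToBin St e b)) →
           (σ : List (Fin m)) → Unique σ → (c : Fin m) → Dec (c ∈ σ) → Position
  follow child σ u c (yes c∈σ) = at (child (toℕ (index c∈σ)) (index<n u c∈σ)) σ u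
  follow child σ u c (no c∉σ)  = at (child (length σ) (fresh<n u c∉σ)) (σ ++ [ c ]) (unique-snoc u c∉σ)

  advance : Position → Fin m → Position
  advance P@(at (overflow _ _) _ _)      c = P
  advance (at (deadend _ _ _ child) σ u) c = follow child σ u c (c ∈? σ)

  positionAfter : Position → History m → Position
  positionAfter P₀ []            = P₀
  positionAfter P₀ ((_ , c) ∷ h) = advance (positionAfter P₀ h) c

  replay : Position → AdvStrategy m
  replay P₀ = record { next    = λ h → itemAt (positionAfter P₀ h)
                     ; nextPos = λ h → itemAt-positive (positionAfter P₀ h) }

  module _ (m>0 : 0 < m) (ℓ₀ St₀ : List ℕ) (P₀ : Position) (B : AlgBehaviour m) where

    round : ℕ → History m
    round = play (replay P₀) B

    replay-wins : ∀ {X ℓ St} (D : OnlineInfeasible m t g X ℓ St) σ u j →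
                  positionAfter P₀ (round j) ≡ at D σ u →
                  ℓ ↭ ℓ₀ ++ map proj₁ (round j) →
                  Dominated (realLoad St₀ (round j)) St σ →
                  ∃ λ j′ → AdvWinsAt m t g ℓ₀ St₀ (round j′)
    replay-wins (overflow t≤max packing) σ u j _ items dom =
      j , dominated-max m>0 dom t≤max , packing⇒partitionable packing items
    replay-wins {ℓ = ℓ} (deadend _ e _ child) σ u j reached items dom =
      continue (c ∈? σ) (cong (λ P → advance P c) reached)
      where
      h : History m
      h = round j
      E : ℕ
      E = itemAt (positionAfter P₀ h)
      c : Fin m
      c = B h E

      E≡e : E ≡ e
      E≡e = cong itemAt reached

      items′ : e ∷ ℓ ↭ ℓ₀ ++ map proj₁ (round (suc j))
      items′ = subst (λ x → e ∷ ℓ ↭ ℓ₀ ++ x ∷ map proj₁ h) (sym E≡e)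
                     (trans (prep e items) (↭-sym (shift e ℓ₀ (map proj₁ h))))

      filled : realLoad St₀ h c + e ≤ realLoad St₀ (round (suc j)) c
      filled = subst (λ x → realLoad St₀ h c + x ≤ realLoad St₀ (round (suc j)) c) E≡e
                     (realLoad-chosen St₀ h E c)

      continue : (c∈?σ : Dec (c ∈ σ)) → positionAfter P₀ (round (suc j)) ≡ follow child σ u c c∈?σ →
                 ∃ λ j′ → AdvWinsAt m t g ℓ₀ St₀ (round j′)
      continue (yes c∈σ) reached′ =
        replay-wins (child _ _) σ u (suc j) reached′ items′
          (dominated-add (realLoad-mono St₀ h E c) e dom c∈σ filled)
      continue (no c∉σ) reached′ =
        replay-wins (child _ _) (σ ++ [ c ]) (unique-snoc u c∉σ) (suc j) reached′ items′
          (dominated-open (realLoad-mono St₀ h E c) e dom (≤-trans (m≤n+m e _) filled))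

open Replay using (at; replay; replay-wins)
open import Data.Integer using (+_; _-_) renaming (_<_ to _<ℤ_)

mainTheorem5 : (m t g : ℕ) → 0 < m →
    (ℓ St : List ℕ) → length St ≤ m → (X : ℕ) →
    (+ (m * g + 1)) - (+ sum ℓ) <ℤ (+ X) →
    OnlineInfeasible m t g X ℓ St → LowerBoundBS m t g ℓ St
mainTheorem5 m t g m>0 ℓ St St≤m X _ D =
  replay m t g P₀ , λ B → replay-wins m t g m>0 ℓ St P₀ B D σ₀ σ₀-unique 0 refl items₀ dominated₀
  where
  σ₀ : List (Fin m)
  σ₀ = firstBins St St≤m
  σ₀-unique : Unique σ₀
  σ₀-unique = firstBins-unique St St≤m
  P₀ : Replay.Position m t g
  P₀ = at D σ₀ σ₀-unique
  items₀ : ℓ ↭ ℓ ++ []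
  items₀ = ↭-reflexive (sym (++-identityʳ ℓ))
  dominated₀ : Dominated (realLoad St []) St σ₀
  dominated₀ = dominated-mono (λ c → m≤m+n (load St (toℕ c)) 0) (firstBins-dominated St St≤m)
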